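{- Let $F$ be an isonemal fabric whose warp and weft stripes (single strands for thin striping, adjacent pairs for thick striping) are coloured with a finite number of colours. If this colouring is perfect, then the number of colours assigned to warps equals the number of colours assigned to wefts.
   Context: Cells are unit squares tessellating the plane; vertical strips are warps, horizontal strips are wefts. A prefabric assigns to each cell which crossing strand is on top; a fabric does not fall apart. With $\tau$ reflection in the plane of the fabric, the symmetry group $G_1$ consists of pairs $(t,r)$, $t$ a plane isometry preserving the cell tessellation and $r\in\{e,\tau\}$, with $t$ mapping the over/under relation to itself ($r=e$) or its reverse ($r=\tau$). Isonemal: periodic with $G_1$ transitive on all strands (warps and wefts). Thin striping colours each strand; thick striping colours adjacent pairs of strands $[2a,2a+2]$. An element $(t,r)\in G_1$ is a colour symmetry if for each colour, $t$ maps all strands of that colour onto strands of one common colour; the colouring is perfect if every element of $G_1$ is a colour symmetry. -}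

module Defs where

open import Data.Bool using (Bool; true; false; if_then_else_; not)
open import Data.Integer as ℤ using (ℤ; _+_; _-_; _*_; -1ℤ; 1ℤ)
open import Data.Nat using (ℕ)
open import Data.Unit using (⊤)
open import Data.Fin using (Fin)
open import Data.Product using (Σ; ∃; ∃-syntax; _×_; _,_)
open import Relation.Binary.PropositionalEquality using (_≡_; _≢_)
open import Relation.Nullary using (¬_)
open import Function.Definitions using (Injective)
open import Function.Bundles using (_⇔_)

-- Cell (i , j) is the unit square [i,i+1] × [j,j+1].
Cell : Set
Cell = ℤ × ℤ

-- Warp i = vertical strip of cells (i , _);  weft j = horizontal strip (_ , j).
data Strand : Set where
  warp : ℤ → Strand
  weft : ℤ → Strand

-- A prefabric: at cell (i , j), true means warp i is on top of weft j,
-- false means weft j is on top of warp i.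
Prefabric : Set
Prefabric = Cell → Bool

top : Prefabric → Cell → Strand
top F (i , j) = if F (i , j) then warp i else weft j

bottom : Prefabric → Cell → Strand
bottom F (i , j) = if F (i , j) then weft j else warp i

-- Plane isometries preserving the tessellation by unit squares with integer
-- corners: x ↦ A x + b with A a signed permutation matrix and b ∈ ℤ².
-- Realised as: optionally swap coordinates, then optionally reflect each
-- coordinate (x ↦ -x), then translate by (bx , by).
record Iso : Set where
  constructor iso
  field
    swap : Bool
    fx   : Bool
    fy   : Bool
    bx   : ℤ
    by   : ℤ

-- effect on a cell coordinate: reflecting x ↦ -x sends cell i to cell -1-i
coord : Bool → ℤ → ℤ → ℤ
coord f b i = (if f then -1ℤ - i else i) + b

actC : Iso → Cell → Cell
actC (iso s fx fy bx by) (i , j) =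
  if s then (coord fx bx j , coord fy by i) else (coord fx bx i , coord fy by j)

actS : Iso → Strand → Strand
actS (iso false fx fy bx by) (warp i) = warp (coord fx bx i)
actS (iso false fx fy bx by) (weft j) = weft (coord fy by j)
actS (iso true  fx fy bx by) (warp i) = weft (coord fy by i)
actS (iso true  fx fy bx by) (weft j) = warp (coord fx bx j)

-- r ∈ {e , τ}; τ is reflection in the plane of the fabric
data R : Set where
  e τ : R

Sym : Prefabric → Iso → R → Set
Sym F t e = ∀ c → top F (actC t c) ≡ actS t (top F c)
Sym F t τ = ∀ c → top F (actC t c) ≡ actS t (bottom F c)

FallsApart : Prefabric → Set
FallsApart F =
  Σ (Strand → Bool) λ S →
    (∃ λ s → S s ≡ true) × (∃ λ s → S s ≡ false) ×
    (∀ i j → S (warp i) ≢ S (weft j) → S (top F (i , j)) ≡ true)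

Fabric : Prefabric → Set
Fabric F = ¬ FallsApart F

translation : ℤ → ℤ → Iso
translation a b = iso false false false a b

Periodic : Prefabric → Set
Periodic F =
  Σ ℤ λ a → Σ ℤ λ b → Σ ℤ λ c → Σ ℤ λ d →
    (a * d - b * c ≢ ℤ.0ℤ) × Sym F (translation a b) e × Sym F (translation c d) e

Isonemal : Prefabric → Set
Isonemal F =
  Periodic F × (∀ s s' → Σ Iso λ t → Σ R λ r → Sym F t r × actS t s ≡ s')

Colouring : ℕ → Set
Colouring k = Strand → Fin k

data Striping : Set where
  thin thick : Striping

-- thin striping: each strand coloured individually;
-- thick striping: the pair of strands [2a, 2a+2] (strands 2a and 2a+1) coloured together.
IsStriping : ∀ {k} → Striping → Colouring k → Set
IsStriping thin  col = ⊤
IsStriping thick col =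
  ∀ a → (col (warp (2ℤ * a)) ≡ col (warp (2ℤ * a + 1ℤ))) ×
        (col (weft (2ℤ * a)) ≡ col (weft (2ℤ * a + 1ℤ)))
  where 2ℤ = ℤ.+ 2

ColourSymmetry : ∀ {k} → Colouring k → Iso → Set
ColourSymmetry col t = ∀ s s' → col s ≡ col s' → col (actS t s) ≡ col (actS t s')

Perfect : ∀ {k} → Prefabric → Colouring k → Set
Perfect F col = ∀ t r → Sym F t r → ColourSymmetry col t

HasSize : ∀ {k} → (Fin k → Set) → ℕ → Set
HasSize {k} P n = Σ (Fin n → Fin k) λ f → Injective _≡_ _≡_ f × (∀ c → P c ⇔ (∃ λ m → f m ≡ c))

WarpColour : ∀ {k} → Colouring k → Fin k → Set
WarpColour col c = ∃ λ i → col (warp i) ≡ c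

WeftColour : ∀ {k} → Colouring k → Fin k → Set
WeftColour col c = ∃ λ j → col (weft j) ≡ c

-- A perfect colouring is preserved by every symmetry, and isonemality provides a symmetry
-- carrying a warp to a weft. Such an isometry swaps the coordinates, so it maps the warps
-- bijectively onto the wefts; being a colour symmetry, it induces an injection from weft
-- colours into warp colours. The symmetry carrying a weft to a warp gives the reverse injection.
module Submission where

open import Defs
open import Data.Nat using (ℕ; _≤_)
open import Data.Nat.Properties using (≤-antisym)
open import Data.Bool using (true; false)
open import Data.Integer as ℤ using (ℤ; -1ℤ)
open import Data.Integer.Tactic.RingSolver using (solve-∀)
open import Data.Fin using (Fin)
open import Data.Fin.Properties using (injective⇒≤)
open import Data.Product using (∃; _,_; proj₁; proj₂)
open import Function using (_∘_)
open import Function.Bundles using (Equivalence)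
open import Function.Definitions using (StrictlySurjective)
open import Relation.Binary.PropositionalEquality
  using (_≡_; refl; sym; trans; cong; subst₂; module ≡-Reasoning)

Image : ∀ {A : Set} {k} → (A → Fin k) → Fin k → Set
Image c x = ∃ λ a → c a ≡ x

image-size-≤ : ∀ {A B : Set} {k m n} (T : A → B) → StrictlySurjective _≡_ T →
  (cA : A → Fin k) (cB : B → Fin k) →
  (∀ a a' → cA a ≡ cA a' → cB (T a) ≡ cB (T a')) →
  HasSize (Image cA) m → HasSize (Image cB) n → n ≤ m
image-size-≤ {A} {m = m} {n} T T-surj cA cB respects
  (f , _ , f-enumerates) (g , g-injective , g-enumerates) = injective⇒≤ φ-injective
  where
  representative : Fin n → A
  representative b = proj₁ (T-surj (proj₁ (Equivalence.from (g-enumerates (g b)) (b , refl))))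

  representative-colour : ∀ b → cB (T (representative b)) ≡ g b
  representative-colour b with Equivalence.from (g-enumerates (g b)) (b , refl)
  ... | y , cB-y≡g-b with T-surj y
  ...   | _ , T-x≡y = trans (cong cB T-x≡y) cB-y≡g-b

  φ : Fin n → Fin m
  φ b = proj₁ (Equivalence.to (f-enumerates (cA (representative b))) (representative b , refl))

  f-φ : ∀ b → f (φ b) ≡ cA (representative b)
  f-φ b = proj₂ (Equivalence.to (f-enumerates (cA (representative b))) (representative b , refl))

  φ-injective : ∀ {b b'} → φ b ≡ φ b' → b ≡ b'
  φ-injective {b} {b'} φb≡φb' = g-injective (begin
    g b                            ≡⟨ sym (representative-colour b) ⟩
    cB (T (representative b))      ≡⟨ respects _ _ same-cA ⟩
    cB (T (representative b'))     ≡⟨ representative-colour b' ⟩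
    g b'                           ∎)
    where
    open ≡-Reasoning
    same-cA : cA (representative b) ≡ cA (representative b')
    same-cA = trans (sym (f-φ b)) (trans (cong f φb≡φb') (f-φ b'))

coord-surjective : ∀ f b → StrictlySurjective _≡_ (coord f b)
coord-surjective false b j = j ℤ.- b , cancel j b
  where
  cancel : ∀ j b → (j ℤ.- b) ℤ.+ b ≡ j
  cancel = solve-∀
coord-surjective true b j = -1ℤ ℤ.- (j ℤ.- b) , cancel j b
  where
  cancel : ∀ j b → (-1ℤ ℤ.- (-1ℤ ℤ.- (j ℤ.- b))) ℤ.+ b ≡ j
  cancel = solve-∀

actS-warp↦weft : ∀ t {i j} → actS t (warp i) ≡ weft j →
  ∀ i' → actS t (warp i') ≡ weft (coord (Iso.fy t) (Iso.by t) i')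
actS-warp↦weft (iso false _ _ _ _) ()
actS-warp↦weft (iso true  _ _ _ _) _ _ = refl

actS-weft↦warp : ∀ t {i j} → actS t (weft j) ≡ warp i →
  ∀ j' → actS t (weft j') ≡ warp (coord (Iso.fx t) (Iso.bx t) j')
actS-weft↦warp (iso false _ _ _ _) ()
actS-weft↦warp (iso true  _ _ _ _) _ _ = refl

colourSymmetry-image-size-≤ : ∀ {k m n} {col : Colouring k} {t : Iso} →
  ColourSymmetry col t → (src tgt : ℤ → Strand) (T : ℤ → ℤ) → StrictlySurjective _≡_ T →
  (∀ a → actS t (src a) ≡ tgt (T a)) →
  HasSize (Image (col ∘ src)) m → HasSize (Image (col ∘ tgt)) n → n ≤ m
colourSymmetry-image-size-≤ {col = col} colour-sym src tgt T T-surj t-src≡tgt-T =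
  image-size-≤ T T-surj (col ∘ src) (col ∘ tgt) respects
  where
  respects : ∀ a a' → col (src a) ≡ col (src a') → col (tgt (T a)) ≡ col (tgt (T a'))
  respects a a' same = subst₂ (λ s s' → col s ≡ col s')
    (t-src≡tgt-T a) (t-src≡tgt-T a') (colour-sym (src a) (src a') same)

lemma3 : (F : Prefabric) → Fabric F → Isonemal F →
    (k : ℕ) (col : Colouring k) (σ : Striping) → IsStriping σ col →
    Perfect F col →
    (m n : ℕ) → HasSize (WarpColour col) m → HasSize (WeftColour col) n → m ≡ n
lemma3 F _ (_ , transitive) k col _ _ perfect m n warp-size weft-size =
  ≤-antisym weft-to-warp warp-to-weft
  where
  warp-to-weft : n ≤ m
  warp-to-weft with transitive (warp ℤ.0ℤ) (weft ℤ.0ℤ)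
  ... | t , r , symmetric , t-warp≡weft =
    colourSymmetry-image-size-≤ (perfect t r symmetric) warp weft
      (coord (Iso.fy t) (Iso.by t)) (coord-surjective (Iso.fy t) (Iso.by t))
      (actS-warp↦weft t t-warp≡weft) warp-size weft-size

  weft-to-warp : m ≤ n
  weft-to-warp with transitive (weft ℤ.0ℤ) (warp ℤ.0ℤ)
  ... | t , r , symmetric , t-weft≡warp =
    colourSymmetry-image-size-≤ (perfect t r symmetric) weft warp
      (coord (Iso.fx t) (Iso.bx t)) (coord-surjective (Iso.fx t) (Iso.bx t))
      (actS-weft↦warp t t-weft≡warp) weft-size warp-size
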